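{- Let $S$ be a finite non-empty set and $B\subseteq\mathbb{R}^S$ an integral base-polyhedron. An element $m$ of $B\cap\mathbb{Z}^S$ minimizes the difference-sum $\Delta(z)=\sum\{|z(s)-z(t)|: s\ne t,\ s,t\in S\}$ over $B\cap\mathbb{Z}^S$ if and only if $m$ is a decreasingly minimal element of $B\cap\mathbb{Z}^S$.
   Context: An integral base-polyhedron is $B=\{x\in\mathbb{R}^S:\widetilde x(S)=b(S),\ \widetilde x(Z)\le b(Z)\ \forall Z\subseteq S\}$ for an integer-valued submodular $b$ ($+\infty$ allowed) with $b(\emptyset)=0$, $b(S)$ finite; $\widetilde x(Z)=\sum_{s\in Z}x(s)$. An element $m$ of a set $Q$ is decreasingly minimal if, after sorting components in decreasing order, it is lexicographically smaller than or equal to every $y\in Q$ sorted likewise. -}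

module Defs where

open import Data.Nat using (ℕ; suc)
open import Data.Integer as ℤ using (ℤ; ∣_∣; _-_)
import Data.Integer.Properties as ℤP
open import Data.Fin using (Fin)
open import Data.Fin.Subset using (Subset; _∈_; _∩_; _∪_; ⊥; ⊤)
open import Data.Bool using (Bool; true; false; if_then_else_)
open import Data.List using (List; reverse; map; allFin)
open import Data.Vec.Functional using (toList)
open import Data.Product using (_×_)
open import Relation.Nullary using (¬_)
open import Relation.Nullary.Decidable using (does)
open import Relation.Binary.PropositionalEquality using (_≡_)
open import Data.List.Relation.Binary.Lex.Strict using (Lex-≤)
import Data.List.Sort as Sort
open import Data.Fin.Subset.Properties using (_∈?_)
open import Data.Fin using (_≟_)

data ℤ∞ : Set where
  fin : ℤ → ℤ∞
  +∞  : ℤ∞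

infixl 6 _⊕_
_⊕_ : ℤ∞ → ℤ∞ → ℤ∞
fin a ⊕ fin b = fin (a ℤ.+ b)
_     ⊕ _     = +∞

infix 4 _≤∞_
data _≤∞_ : ℤ∞ → ℤ∞ → Set where
  fin≤fin : ∀ {a b} → a ℤ.≤ b → fin a ≤∞ fin b
  _≤+∞    : ∀ x → x ≤∞ +∞

sumAll : ∀ {n} → (Fin n → ℤ) → ℤ
sumAll {n} f = Data.List.foldr ℤ._+_ (ℤ.+ 0) (map f (allFin n))

x̃ : ∀ {n} → (Fin n → ℤ) → Subset n → ℤ
x̃ x Z = sumAll (λ s → if does (s ∈? Z) then x s else ℤ.+ 0)

record IsBorder {n : ℕ} (b : Subset n → ℤ∞) : Set where
  field
    submodular : ∀ X Y → (b (X ∩ Y) ⊕ b (X ∪ Y)) ≤∞ (b X ⊕ b Y)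
    empty-zero : b ⊥ ≡ fin (ℤ.+ 0)
    full-finite : ¬ (b ⊤ ≡ +∞)

InB : ∀ {n} → (Subset n → ℤ∞) → (Fin n → ℤ) → Set
InB b x = (b ⊤ ≡ fin (x̃ x ⊤)) × (∀ Z → fin (x̃ x Z) ≤∞ b Z)

-- Difference-sum Δ(z) = Σ { |z(s) − z(t)| : s ≠ t } (over ordered pairs).
Δ : ∀ {n} → (Fin n → ℤ) → ℕ
Δ z = Data.List.foldr Data.Nat._+_ 0
        (map (λ s → Data.List.foldr Data.Nat._+_ 0
           (map (λ t → if does (s ≟ t) then 0 else ∣ z s - z t ∣) (allFin _)))
         (allFin _))

module IntSort = Sort ℤP.≤-decTotalOrder

sortDec : ∀ {n} → (Fin n → ℤ) → List ℤ
sortDec x = reverse (IntSort.sort (toList x))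

_≤lex_ : List ℤ → List ℤ → Set
_≤lex_ = Lex-≤ _≡_ ℤ._<_

ΔMinimizer : ∀ {n} → (Subset n → ℤ∞) → (Fin n → ℤ) → Set
ΔMinimizer b m = InB b m × (∀ z → InB b z → Data.Nat._≤_ (Δ m) (Δ z))

DecMin : ∀ {n} → (Subset n → ℤ∞) → (Fin n → ℤ) → Set
DecMin b m = InB b m × (∀ y → InB b y → sortDec m ≤lex sortDec y)

-- A move of one unit from u to v with m(v) + 2 ≤ m(u) stays in B when no m-tight
-- set contains v but not u, and it strictly decreases Δ.  If every such move is
-- blocked, intersecting and uniting the blocking sets (tight sets form a lattice,
-- by submodularity of b and modularity of x̃) gives for each level d an m-tight
-- set T with {m < d} ⊆ T ⊆ {m ≤ d}.  As T is tight, m puts the least possible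
-- mass on S ∖ T, so Σ (m(t) − d)⁺ ≤ Σ (y(t) − d)⁺ for every y ∈ B and every d,
-- and these inequalities force sort(m) ≤lex sort(y).  Hence a Δ-minimiser is
-- decreasingly minimal.  Conversely, descending from any z by such moves ends in
-- a decreasingly minimal z′, whose sorted vector equals that of m, so
-- Δ(m) = Δ(z′) ≤ Δ(z).

module Submission where

open import Defs
open import Data.Nat using (ℕ; suc)
open import Data.Integer using (ℤ)
open import Data.Fin using (Fin)
open import Data.Fin.Subset using (Subset)
open import Data.Product using (_×_)

import Algebra.Properties.CommutativeMonoid.Sum as MonoidSum
open import Data.Bool using (Bool; true; false; not; _∧_; _∨_; if_then_else_)
open import Data.Fin using (zero; suc; _≟_; punchIn; punchOut)
import Data.Fin.Properties as FinP
open import Data.Fin.Subset using (_∈_; _∉_; _∩_; _∪_; ∁; ⊥; ⊤; ⋂; ⋃)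
open import Data.Fin.Subset.Properties
  using (_∈?_; x∈p∩q⁺; x∈p∩q⁻; x∈p∪q⁺; x∈p∪q⁻; ∈⊤; ∉⊥; anySubset?)
open import Data.Integer as ℤ using (+_; _+_; _-_; -_; _≤_; _<_; _⊔_; ∣_∣)
import Data.Integer.Properties as ℤP
open import Data.Integer.Tactic.RingSolver using (solve-∀)
open import Data.Nat as ℕ using (zero)
import Data.Nat.Properties as ℕP
open import Data.Nat.Induction using (<-wellFounded)
open import Data.Nat.ListAction using () renaming (sum to sumℕ)
open import Data.Nat.ListAction.Properties using () renaming (sum-↭ to sumℕ-↭)
open import Data.Nat.Tactic.RingSolver using () renaming (solve-∀ to solveℕ-∀)
open import Data.List using (List; []; _∷_; foldr; map; tabulate; reverse; allFin)
import Data.List.Properties as ListP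
open import Data.List.Relation.Unary.All as All using (All; []; _∷_)
import Data.List.Relation.Unary.All.Properties as AllP
open import Data.List.Relation.Unary.Any using (Any; here; there)
import Data.List.Relation.Unary.Any.Properties as AnyP
open import Data.List.Relation.Unary.AllPairs using (AllPairs; []; _∷_)
import Data.List.Relation.Unary.AllPairs.Properties as AllPairsP
import Data.List.Relation.Unary.Linked.Properties as LinkedP
open import Data.List.Relation.Binary.Permutation.Propositional
  using (_↭_; ↭-refl; ↭-prep; ↭-swap; ↭-sym; ↭-trans; ↭⇒↭ₛ)
import Data.List.Relation.Binary.Permutation.Propositional.Properties as PermP
import Data.List.Relation.Binary.Permutation.Setoid.Properties as PermSetoidP
open import Data.List.Relation.Binary.Lex.Core using (base; halt; this; next)
open import Data.List.Relation.Binary.Lex.Strict using (≤-antisymmetric)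
open import Data.List.Relation.Binary.Pointwise using (Pointwise-≡⇒≡)
open import Data.Product using (_,_; proj₁; proj₂; Σ-syntax; ∃-syntax)
open import Data.Sum using (_⊎_; inj₁; inj₂)
open import Data.Unit using (tt)
open import Data.Vec using (lookup) renaming (_∷_ to _∷ᵛ_)
open import Data.Vec.Properties using (lookup-zipWith; lookup-map; lookup-replicate; lookup⇒[]=; []=⇒lookup)
open import Data.Vec.Functional using (toList; removeAt)
open import Function using (_∘_; id)
open import Induction.WellFounded using (Acc; acc)
open import Relation.Binary.Definitions using (DecidableEquality; tri<; tri≈; tri>)
open import Relation.Binary.PropositionalEquality
  using (_≡_; _≢_; refl; sym; trans; cong; cong₂; subst; subst₂; module ≡-Reasoning)
open import Relation.Nullary using (¬_; Dec; yes; no; does; contradiction)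
import Relation.Nullary.Decidable as Dec
open import Relation.Nullary.Decidable using (_×-dec_; ¬?)

private
  variable
    n : ℕ

+-cancelˡ-≤ : ∀ k {i j} → k + i ≤ k + j → i ≤ j
+-cancelˡ-≤ k {i} {j} k+i≤k+j = subst₂ _≤_ (cancel k i) (cancel k j) (ℤP.+-monoʳ-≤ (- k) k+i≤k+j)
  where
  cancel : ∀ k x → - k + (k + x) ≡ x
  cancel = solve-∀

i-j+j≡i : ∀ i j → i - j + j ≡ i
i-j+j≡i = solve-∀

fin-injective : ∀ {a c} → fin a ≡ fin c → a ≡ c
fin-injective refl = refl

_≟∞_ : DecidableEquality ℤ∞
fin a ≟∞ fin c = Dec.map′ (cong fin) fin-injective (a ℤ.≟ c)
fin _ ≟∞ +∞    = no λ ()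
+∞    ≟∞ fin _ = no λ ()
+∞    ≟∞ +∞    = yes refl

fin-≤∞-trans : ∀ {a c P} → a ≤ c → fin c ≤∞ P → fin a ≤∞ P
fin-≤∞-trans a≤c (fin≤fin c≤p) = fin≤fin (ℤP.≤-trans a≤c c≤p)
fin-≤∞-trans a≤c (_ ≤+∞)       = _ ≤+∞

fin-≤∞-≢ : ∀ {a P} → fin a ≤∞ P → P ≢ fin a → fin (a + + 1) ≤∞ P
fin-≤∞-≢ {a} (fin≤fin a≤p) p≢a =
  fin≤fin (subst (_≤ _) (ℤP.+-comm (+ 1) a) (ℤP.i<j⇒suc[i]≤j (ℤP.≤∧≢⇒< a≤p (p≢a ∘ cong fin ∘ sym))))
fin-≤∞-≢ (_ ≤+∞) _ = _ ≤+∞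

⊕-squeeze : ∀ {P Q a c} → fin a ≤∞ P → fin c ≤∞ Q → P ⊕ Q ≤∞ fin (a + c) → P ≡ fin a × Q ≡ fin c
⊕-squeeze {a = a} {c} (fin≤fin {b = p} a≤p) (fin≤fin {b = q} c≤q) (fin≤fin p+q≤a+c) =
  cong fin (ℤP.≤-antisym p≤a a≤p) , cong fin (ℤP.≤-antisym q≤c c≤q)
  where
  p≤a : p ≤ a
  p≤a = +-cancelˡ-≤ q (subst₂ _≤_ (ℤP.+-comm p q) (ℤP.+-comm a q)
          (ℤP.≤-trans p+q≤a+c (ℤP.+-monoʳ-≤ a c≤q)))
  q≤c : q ≤ c
  q≤c = +-cancelˡ-≤ p (ℤP.≤-trans p+q≤a+c (ℤP.+-monoˡ-≤ c a≤p))

open MonoidSum ℤP.+-0-commutativeMonoid using (sum; sum-cong-≗; ∑-distrib-+; sum-remove; sum-replicate-zero)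

sum-mono-≤ : {f g : Fin n → ℤ} → (∀ i → f i ≤ g i) → sum f ≤ sum g
sum-mono-≤ {zero}  f≤g = ℤP.≤-refl
sum-mono-≤ {suc n} f≤g = ℤP.+-mono-≤ (f≤g zero) (sum-mono-≤ (f≤g ∘ suc))

sum-neg : (f : Fin n → ℤ) → sum (λ i → - f i) ≡ - sum f
sum-neg {zero}  f = refl
sum-neg {suc n} f = trans (cong (_+_ (- f zero)) (sum-neg (f ∘ suc))) (sym (ℤP.neg-distrib-+ (f zero) _))

sum-zero : {f : Fin n → ℤ} → (∀ i → f i ≡ + 0) → sum f ≡ + 0
sum-zero {n} f≡0 = trans (sum-cong-≗ f≡0) (sum-replicate-zero n)

sum-single : {f : Fin n → ℤ} (v : Fin n) → (∀ i → i ≢ v → f i ≡ + 0) → sum f ≡ f v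
sum-single {suc n} {f} v off = begin
  sum f                        ≡⟨ sum-remove f ⟩
  f v + sum (removeAt f v)     ≡⟨ cong (_+_ (f v)) (sum-zero (λ i → off _ (FinP.punchInᵢ≢i v i))) ⟩
  f v + + 0                    ≡⟨ ℤP.+-identityʳ (f v) ⟩
  f v                          ∎
  where open ≡-Reasoning

foldr-tabulate : (f : Fin n → ℤ) → foldr _+_ (+ 0) (tabulate f) ≡ sum f
foldr-tabulate {zero}  f = refl
foldr-tabulate {suc n} f = cong (_+_ (f zero)) (foldr-tabulate (f ∘ suc))

sumAll≡sum : (f : Fin n → ℤ) → sumAll f ≡ sum f
sumAll≡sum f = trans (cong (foldr _+_ (+ 0)) (ListP.map-tabulate id f)) (foldr-tabulate f)

_⁺ : ℤ → ℤ
i ⁺ = i ⊔ + 0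

infixr 7 [_]·_
[_]·_ : Bool → ℤ → ℤ
[ b ]· k = if b then k else + 0

[]·-zero : ∀ b → [ b ]· + 0 ≡ + 0
[]·-zero true  = refl
[]·-zero false = refl

[]·-≤-⁺ : ∀ b k → [ b ]· k ≤ k ⁺
[]·-≤-⁺ true  k = ℤP.i≤i⊔j k (+ 0)
[]·-≤-⁺ false k = ℤP.i≤j⊔i k (+ 0)

[]·-∧-∨ : ∀ a b k → [ a ∧ b ]· k + [ a ∨ b ]· k ≡ [ a ]· k + [ b ]· k
[]·-∧-∨ true  true  k = refl
[]·-∧-∨ true  false k = ℤP.+-comm (+ 0) k
[]·-∧-∨ false b     k = refl

[]·-not : ∀ b k → [ b ]· k + [ not b ]· k ≡ k
[]·-not true  k = ℤP.+-identityʳ k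
[]·-not false k = ℤP.+-identityˡ k

restrict : Subset n → (Fin n → ℤ) → Fin n → ℤ
restrict Z x s = [ lookup Z s ]· x s

does-∈? : (s : Fin n) (Z : Subset n) → does (s ∈? Z) ≡ lookup Z s
does-∈? zero    (true  ∷ᵛ Z) = refl
does-∈? zero    (false ∷ᵛ Z) = refl
does-∈? (suc s) (_     ∷ᵛ Z) = does-∈? s Z

lookup≡false⇒∉ : ∀ {s : Fin n} {Z} → lookup Z s ≡ false → s ∉ Z
lookup≡false⇒∉ Z[s]≡false s∈Z = contradiction (trans (sym ([]=⇒lookup s∈Z)) Z[s]≡false) λ ()

x̃≡sum : (x : Fin n → ℤ) (Z : Subset n) → x̃ x Z ≡ sum (restrict Z x)
x̃≡sum x Z = trans (sumAll≡sum (λ s → [ does (s ∈? Z) ]· x s)) (sum-cong-≗ λ s → cong ([_]· x s) (does-∈? s Z))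

x̃-+ : (f g : Fin n → ℤ) (Z : Subset n) → x̃ (λ s → f s + g s) Z ≡ x̃ f Z + x̃ g Z
x̃-+ f g Z = begin
  x̃ (λ s → f s + g s) Z                          ≡⟨ x̃≡sum _ Z ⟩
  sum (restrict Z (λ s → f s + g s))             ≡⟨ sum-cong-≗ restrict-+ ⟩
  sum (λ s → restrict Z f s + restrict Z g s)    ≡⟨ ∑-distrib-+ (restrict Z f) (restrict Z g) ⟩
  sum (restrict Z f) + sum (restrict Z g)        ≡⟨ cong₂ _+_ (x̃≡sum f Z) (x̃≡sum g Z) ⟨
  x̃ f Z + x̃ g Z                                  ∎
  where
  open ≡-Reasoning
  restrict-+ : ∀ s → restrict Z (λ s → f s + g s) s ≡ restrict Z f s + restrict Z g s
  restrict-+ s with lookup Z s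
  ... | true  = refl
  ... | false = refl

x̃-neg : (f : Fin n → ℤ) (Z : Subset n) → x̃ (λ s → - f s) Z ≡ - x̃ f Z
x̃-neg f Z = begin
  x̃ (λ s → - f s) Z               ≡⟨ x̃≡sum _ Z ⟩
  sum (restrict Z (λ s → - f s))  ≡⟨ sum-cong-≗ restrict-neg ⟩
  sum (λ s → - restrict Z f s)    ≡⟨ sum-neg (restrict Z f) ⟩
  - sum (restrict Z f)            ≡⟨ cong -_ (x̃≡sum f Z) ⟨
  - x̃ f Z                         ∎
  where
  open ≡-Reasoning
  restrict-neg : ∀ s → restrict Z (λ s → - f s) s ≡ - restrict Z f s
  restrict-neg s with lookup Z s
  ... | true  = refl
  ... | false = refl

x̃-sub : (f g : Fin n → ℤ) (Z : Subset n) → x̃ (λ s → f s - g s) Z ≡ x̃ f Z - x̃ g Z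
x̃-sub f g Z = trans (x̃-+ f (λ s → - g s) Z) (cong (_+_ (x̃ f Z)) (x̃-neg g Z))

x̃-modular : (x : Fin n → ℤ) (X Y : Subset n) → x̃ x (X ∩ Y) + x̃ x (X ∪ Y) ≡ x̃ x X + x̃ x Y
x̃-modular x X Y = begin
  x̃ x (X ∩ Y) + x̃ x (X ∪ Y)                                ≡⟨ cong₂ _+_ (x̃≡sum x (X ∩ Y)) (x̃≡sum x (X ∪ Y)) ⟩
  sum (restrict (X ∩ Y) x) + sum (restrict (X ∪ Y) x)     ≡⟨ ∑-distrib-+ (restrict (X ∩ Y) x) _ ⟨
  sum (λ s → restrict (X ∩ Y) x s + restrict (X ∪ Y) x s) ≡⟨ sum-cong-≗ restrict-modular ⟩
  sum (λ s → restrict X x s + restrict Y x s)             ≡⟨ ∑-distrib-+ (restrict X x) _ ⟩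
  sum (restrict X x) + sum (restrict Y x)                 ≡⟨ cong₂ _+_ (x̃≡sum x X) (x̃≡sum x Y) ⟨
  x̃ x X + x̃ x Y                                           ∎
  where
  open ≡-Reasoning
  restrict-modular : ∀ s → restrict (X ∩ Y) x s + restrict (X ∪ Y) x s ≡ restrict X x s + restrict Y x s
  restrict-modular s =
    trans (cong₂ (λ a b → [ a ]· x s + [ b ]· x s) (lookup-zipWith _∧_ s X Y) (lookup-zipWith _∨_ s X Y))
          ([]·-∧-∨ (lookup X s) (lookup Y s) (x s))

x̃-∁ : (x : Fin n → ℤ) (Z : Subset n) → x̃ x Z + x̃ x (∁ Z) ≡ x̃ x ⊤
x̃-∁ x Z = begin
  x̃ x Z + x̃ x (∁ Z)                               ≡⟨ cong₂ _+_ (x̃≡sum x Z) (x̃≡sum x (∁ Z)) ⟩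
  sum (restrict Z x) + sum (restrict (∁ Z) x)     ≡⟨ ∑-distrib-+ (restrict Z x) _ ⟨
  sum (λ s → restrict Z x s + restrict (∁ Z) x s) ≡⟨ sum-cong-≗ split ⟩
  sum (restrict ⊤ x)                              ≡⟨ x̃≡sum x ⊤ ⟨
  x̃ x ⊤                                           ∎
  where
  open ≡-Reasoning
  split : ∀ s → restrict Z x s + restrict (∁ Z) x s ≡ restrict ⊤ x s
  split s = begin
    [ lookup Z s ]· x s + [ lookup (∁ Z) s ]· x s ≡⟨ cong (λ a → [ lookup Z s ]· x s + [ a ]· x s) (lookup-map s not Z) ⟩
    [ lookup Z s ]· x s + [ not (lookup Z s) ]· x s ≡⟨ []·-not (lookup Z s) (x s) ⟩
    x s                                             ≡⟨ cong ([_]· x s) (lookup-replicate s true) ⟨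
    [ lookup ⊤ s ]· x s                             ∎

x̃-⊥ : (x : Fin n → ℤ) → x̃ x ⊥ ≡ + 0
x̃-⊥ x = trans (x̃≡sum x ⊥) (sum-zero λ s → cong ([_]· x s) (lookup-replicate s false))

-- Tight sets

x∈⋂⁺ : ∀ {s : Fin n} {Zs} → All (s ∈_) Zs → s ∈ ⋂ Zs
x∈⋂⁺ []           = ∈⊤
x∈⋂⁺ (s∈Z ∷ s∈Zs) = x∈p∩q⁺ (s∈Z , x∈⋂⁺ s∈Zs)

x∈⋂⁻ : ∀ {s : Fin n} Zs → s ∈ ⋂ Zs → All (s ∈_) Zs
x∈⋂⁻ []       _   = []
x∈⋂⁻ (Z ∷ Zs) s∈⋂ = let s∈Z , s∈⋂Zs = x∈p∩q⁻ Z (⋂ Zs) s∈⋂ in s∈Z ∷ x∈⋂⁻ Zs s∈⋂Zs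

x∈⋃⁺ : ∀ {s : Fin n} {Zs} → Any (s ∈_) Zs → s ∈ ⋃ Zs
x∈⋃⁺ (here s∈Z)   = x∈p∪q⁺ (inj₁ s∈Z)
x∈⋃⁺ (there s∈Zs) = x∈p∪q⁺ (inj₂ (x∈⋃⁺ s∈Zs))

x∈⋃⁻ : ∀ {s : Fin n} Zs → s ∈ ⋃ Zs → Any (s ∈_) Zs
x∈⋃⁻ []       s∈⊥ = contradiction s∈⊥ ∉⊥
x∈⋃⁻ (Z ∷ Zs) s∈⋃ with x∈p∪q⁻ Z (⋃ Zs) s∈⋃
... | inj₁ s∈Z   = here s∈Z
... | inj₂ s∈⋃Zs = there (x∈⋃⁻ Zs s∈⋃Zs)

Tight : (Subset n → ℤ∞) → (Fin n → ℤ) → Subset n → Set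
Tight b x Z = b Z ≡ fin (x̃ x Z)

module _ {b : Subset n → ℤ∞} (isBorder : IsBorder b) {x : Fin n → ℤ} (x∈B : InB b x) where

  tight-∩-∪ : ∀ {X Y} → Tight b x X → Tight b x Y → Tight b x (X ∩ Y) × Tight b x (X ∪ Y)
  tight-∩-∪ {X} {Y} tightX tightY = ⊕-squeeze (proj₂ x∈B (X ∩ Y)) (proj₂ x∈B (X ∪ Y))
    (subst (b (X ∩ Y) ⊕ b (X ∪ Y) ≤∞_) (trans (cong₂ _⊕_ tightX tightY) (cong fin (sym (x̃-modular x X Y))))
      (IsBorder.submodular isBorder X Y))

  tight-⊤ : Tight b x ⊤
  tight-⊤ = proj₁ x∈B

  tight-⊥ : Tight b x ⊥
  tight-⊥ = trans (IsBorder.empty-zero isBorder) (cong fin (sym (x̃-⊥ x)))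

  tight-⋂ : ∀ {Zs} → All (Tight b x) Zs → Tight b x (⋂ Zs)
  tight-⋂ []               = tight-⊤
  tight-⋂ (tight ∷ tights) = proj₁ (tight-∩-∪ tight (tight-⋂ tights))

  tight-⋃ : ∀ {Zs} → All (Tight b x) Zs → Tight b x (⋃ Zs)
  tight-⋃ []               = tight-⊥
  tight-⋃ (tight ∷ tights) = proj₂ (tight-∩-∪ tight (tight-⋃ tights))

tight-∁-minimal : ∀ {b : Subset n → ℤ∞} {m y T} → InB b m → InB b y → Tight b m T → x̃ m (∁ T) ≤ x̃ y (∁ T)
tight-∁-minimal {m = m} {y} {T} (totalm , _) (totaly , feasibley) tight = +-cancelˡ-≤ (x̃ y T) (begin
  x̃ y T + x̃ m (∁ T)  ≤⟨ ℤP.+-monoˡ-≤ (x̃ m (∁ T)) yT≤mT ⟩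
  x̃ m T + x̃ m (∁ T)  ≡⟨ x̃-∁ m T ⟩
  x̃ m ⊤              ≡⟨ fin-injective (trans (sym totalm) totaly) ⟩
  x̃ y ⊤              ≡⟨ x̃-∁ y T ⟨
  x̃ y T + x̃ y (∁ T)  ∎)
  where
  open ℤP.≤-Reasoning
  yT≤mT : x̃ y T ≤ x̃ m T
  yT≤mT with subst (fin (x̃ y T) ≤∞_) tight (feasibley T)
  ... | fin≤fin y≤m = y≤m

-- Unit moves

𝟙 : Fin n → Fin n → ℤ
𝟙 v s = if does (v ≟ s) then + 1 else + 0

𝟙-diag : (v : Fin n) → 𝟙 v v ≡ + 1
𝟙-diag v with v ≟ v
... | yes _   = refl
... | no  v≢v = contradiction refl v≢v

𝟙-off : {v s : Fin n} → v ≢ s → 𝟙 v s ≡ + 0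
𝟙-off {v = v} {s} v≢s with v ≟ s
... | yes v≡s = contradiction v≡s v≢s
... | no  _   = refl

x̃-𝟙 : (v : Fin n) (Z : Subset n) → x̃ (𝟙 v) Z ≡ [ lookup Z v ]· + 1
x̃-𝟙 v Z = begin
  x̃ (𝟙 v) Z              ≡⟨ x̃≡sum (𝟙 v) Z ⟩
  sum (restrict Z (𝟙 v)) ≡⟨ sum-single v (λ s s≢v → trans (cong ([ lookup Z s ]·_) (𝟙-off (s≢v ∘ sym))) ([]·-zero _)) ⟩
  [ lookup Z v ]· 𝟙 v v  ≡⟨ cong ([ lookup Z v ]·_) (𝟙-diag v) ⟩
  [ lookup Z v ]· + 1    ∎
  where open ≡-Reasoning

moveUnit : (Fin n → ℤ) → (from to : Fin n) → Fin n → ℤ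
moveUnit x u v s = x s - 𝟙 u s + 𝟙 v s

x̃-moveUnit : (x : Fin n → ℤ) (u v : Fin n) (Z : Subset n) →
  x̃ (moveUnit x u v) Z ≡ x̃ x Z - [ lookup Z u ]· + 1 + [ lookup Z v ]· + 1
x̃-moveUnit x u v Z = begin
  x̃ (moveUnit x u v) Z                       ≡⟨ x̃-+ (λ s → x s - 𝟙 u s) (𝟙 v) Z ⟩
  x̃ (λ s → x s - 𝟙 u s) Z + x̃ (𝟙 v) Z       ≡⟨ cong₂ _+_ (x̃-sub x (𝟙 u) Z) (x̃-𝟙 v Z) ⟩
  x̃ x Z - x̃ (𝟙 u) Z + [ lookup Z v ]· + 1   ≡⟨ cong (λ a → x̃ x Z - a + [ lookup Z v ]· + 1) (x̃-𝟙 u Z) ⟩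
  x̃ x Z - [ lookup Z u ]· + 1 + [ lookup Z v ]· + 1 ∎
  where open ≡-Reasoning

moveUnit-at-from : (x : Fin n → ℤ) {u v : Fin n} → v ≢ u → moveUnit x u v u ≡ x u - + 1
moveUnit-at-from x {u} v≢u = trans (cong₂ (λ a c → x u - a + c) (𝟙-diag u) (𝟙-off v≢u)) (ℤP.+-identityʳ _)

moveUnit-at-to : (x : Fin n → ℤ) {u v : Fin n} → u ≢ v → moveUnit x u v v ≡ x v + + 1
moveUnit-at-to x {u} {v} u≢v = trans (cong₂ (λ a c → x v - a + c) (𝟙-off u≢v) (𝟙-diag v)) (cong (_+ + 1) (ℤP.+-identityʳ (x v)))

moveUnit-elsewhere : (x : Fin n → ℤ) {u v s : Fin n} → u ≢ s → v ≢ s → moveUnit x u v s ≡ x s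
moveUnit-elsewhere x {s = s} u≢s v≢s =
  trans (cong₂ (λ a c → x s - a + c) (𝟙-off u≢s) (𝟙-off v≢s)) (trans (ℤP.+-identityʳ _) (ℤP.+-identityʳ (x s)))

TightSeparator : (Subset n → ℤ∞) → (Fin n → ℤ) → Fin n → Fin n → Set
TightSeparator b x v u = ∃[ Z ] Tight b x Z × v ∈ Z × u ∉ Z

tightSeparator? : (b : Subset n → ℤ∞) (x : Fin n → ℤ) (v u : Fin n) → Dec (TightSeparator b x v u)
tightSeparator? b x v u = anySubset? λ Z → (b Z ≟∞ fin (x̃ x Z)) ×-dec (v ∈? Z) ×-dec ¬? (u ∈? Z)

fin-shift-≤∞ : ∀ {a P} bu bv → fin a ≤∞ P → (bv ≡ true → bu ≡ false → P ≢ fin a) →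
  fin (a - [ bu ]· + 1 + [ bv ]· + 1) ≤∞ P
fin-shift-≤∞ {a} true  true  a≤P _        = subst (λ c → fin c ≤∞ _) (sym (i-j+j≡i a (+ 1))) a≤P
fin-shift-≤∞ {a} false false a≤P _        = subst (λ c → fin c ≤∞ _) (sym (i-j+j≡i a (+ 0))) a≤P
fin-shift-≤∞ {a} true  false a≤P _        =
  fin-≤∞-trans (ℤP.≤-trans (ℤP.≤-reflexive (ℤP.+-identityʳ (a - + 1))) (ℤP.i≤j⇒i-k≤j (+ 1) ℤP.≤-refl)) a≤P
fin-shift-≤∞ {a} false true  a≤P nonTight =
  subst (λ c → fin c ≤∞ _) (cong (_+ + 1) (sym (ℤP.+-identityʳ a))) (fin-≤∞-≢ a≤P (nonTight refl refl))

x̃-moveUnit-⊤ : (x : Fin n → ℤ) (u v : Fin n) → x̃ (moveUnit x u v) ⊤ ≡ x̃ x ⊤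
x̃-moveUnit-⊤ x u v = begin
  x̃ (moveUnit x u v) ⊤                              ≡⟨ x̃-moveUnit x u v ⊤ ⟩
  x̃ x ⊤ - [ lookup ⊤ u ]· + 1 + [ lookup ⊤ v ]· + 1 ≡⟨ cong₂ (λ a c → x̃ x ⊤ - [ a ]· + 1 + [ c ]· + 1)
                                                         (lookup-replicate u true) (lookup-replicate v true) ⟩
  x̃ x ⊤ - + 1 + + 1                                 ≡⟨ i-j+j≡i (x̃ x ⊤) (+ 1) ⟩
  x̃ x ⊤                                             ∎
  where open ≡-Reasoning

moveUnit-InB : ∀ {b : Subset n → ℤ∞} {x u v} → InB b x → ¬ TightSeparator b x v u → InB b (moveUnit x u v)
moveUnit-InB {b = b} {x} {u} {v} (total , feasible) noSeparator =
  trans total (cong fin (sym (x̃-moveUnit-⊤ x u v))) , λ Z →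
    subst (λ c → fin c ≤∞ b Z) (sym (x̃-moveUnit x u v Z))
      (fin-shift-≤∞ (lookup Z u) (lookup Z v) (feasible Z) λ v∈Z u∉Z tight →
        noSeparator (Z , tight , lookup⇒[]= v Z v∈Z , lookup≡false⇒∉ u∉Z))

Blocked : (Subset n → ℤ∞) → (Fin n → ℤ) → Set
Blocked b x = ∀ u v → x v + + 2 ≤ x u → TightSeparator b x v u

tighteningMove-or-blocked : (b : Subset n → ℤ∞) (x : Fin n → ℤ) → InB b x →
  (∃[ u ] ∃[ v ] x v + + 2 ≤ x u × InB b (moveUnit x u v)) ⊎ Blocked b x
tighteningMove-or-blocked b x x∈B
  with FinP.any? (λ u → FinP.any? (λ v → (x v + + 2 ℤP.≤? x u) ×-dec ¬? (tightSeparator? b x v u)))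
... | yes (u , v , gap , noSeparator) = inj₁ (u , v , gap , moveUnit-InB x∈B noSeparator)
... | no noMove = inj₂ λ u v gap → Dec.decidable-stable (tightSeparator? b x v u) λ noSeparator → noMove (u , v , gap , noSeparator)

-- A tight set between two consecutive level sets

module _ {b : Subset n → ℤ∞} (isBorder : IsBorder b) {m : Fin n → ℤ} (m∈B : InB b m) (blocked : Blocked b m) where

  private
    record Separator (v u : Fin n) : Set where
      field
        set        : Subset n
        tight      : Tight b m set
        contains-v : v ∈ set
        excludes-u : m v + + 2 ≤ m u → u ∉ set

    separator : ∀ v u → Separator v u
    separator v u with m v + + 2 ℤP.≤? m u
    ... | yes gap = let Z , tight , v∈Z , u∉Z = blocked u v gap in
      record { set = Z ; tight = tight ; contains-v = v∈Z ; excludes-u = λ _ → u∉Z }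
    ... | no ¬gap =
      record { set = ⊤ ; tight = tight-⊤ isBorder m∈B ; contains-v = ∈⊤ ; excludes-u = λ gap → contradiction gap ¬gap }

    record LowerPart (d : ℤ) (v : Fin n) : Set where
      field
        set        : Subset n
        tight      : Tight b m set
        contains-v : m v < d → v ∈ set
        within     : ∀ t → t ∈ set → m t ≤ d

    lowerPart : ∀ d v → LowerPart d v
    lowerPart d v with m v ℤP.<? d
    ... | yes mv<d = record
      { set        = ⋂ Zs
      ; tight      = tight-⋂ isBorder m∈B (AllP.tabulate⁺ (Separator.tight ∘ separator v))
      ; contains-v = λ _ → x∈⋂⁺ (AllP.tabulate⁺ (Separator.contains-v ∘ separator v))
      ; within     = within
      }
      where
      Zs = tabulate (Separator.set ∘ separator v)
      within : ∀ t → t ∈ ⋂ Zs → m t ≤ d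
      within t t∈⋂ = ℤP.≤-trans (ℤP.i<j⇒i≤pred[j] (ℤP.≰⇒> noGap)) (subst (_≤ d) (suc≡pred+2 (m v)) (ℤP.i<j⇒suc[i]≤j mv<d))
        where
        noGap : ¬ (m v + + 2 ≤ m t)
        noGap gap = Separator.excludes-u (separator v t) gap (AllP.tabulate⁻ (x∈⋂⁻ Zs t∈⋂) t)
        suc≡pred+2 : ∀ a → + 1 + a ≡ - + 1 + (a + + 2)
        suc≡pred+2 = solve-∀
    ... | no mv≮d = record
      { set        = ⊥
      ; tight      = tight-⊥ isBorder m∈B
      ; contains-v = λ mv<d → contradiction mv<d mv≮d
      ; within     = λ _ t∈⊥ → contradiction t∈⊥ ∉⊥
      }

  tight-between-levels : ∀ d → Σ[ T ∈ Subset n ] Tight b m T × (∀ t → m t < d → t ∈ T) × (∀ t → t ∈ T → m t ≤ d)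
  tight-between-levels d = ⋃ Ts , tight-⋃ isBorder m∈B (AllP.tabulate⁺ (LowerPart.tight ∘ lowerPart d)) , contains , within
    where
    Ts = tabulate (LowerPart.set ∘ lowerPart d)
    contains : ∀ t → m t < d → t ∈ ⋃ Ts
    contains t mt<d = x∈⋃⁺ (AnyP.tabulate⁺ t (LowerPart.contains-v (lowerPart d t) mt<d))
    within : ∀ t → t ∈ ⋃ Ts → m t ≤ d
    within t t∈⋃ = let v , t∈Tv = AnyP.tabulate⁻ (x∈⋃⁻ Ts t∈⋃) in LowerPart.within (lowerPart d v) t t∈Tv

-- Excess over a level, and the lexicographic order

excess : ℤ → List ℤ → ℤ
excess d as = foldr _+_ (+ 0) (map (λ a → (a - d) ⁺) as)

excess-↭ : ∀ d {as bs} → as ↭ bs → excess d as ≡ excess d bs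
excess-↭ d as↭bs = PermSetoidP.foldr-commMonoid ℤP.≡-setoid ℤP.+-0-isCommutativeMonoid (↭⇒↭ₛ (PermP.map⁺ _ as↭bs))

excess-toList : ∀ d (x : Fin n → ℤ) → excess d (toList x) ≡ sum (λ t → (x t - d) ⁺)
excess-toList d x = trans (cong (foldr _+_ (+ 0)) (ListP.map-tabulate x _)) (foldr-tabulate (λ t → (x t - d) ⁺))

excess-≤ : ∀ {b : Subset n → ℤ∞} {m y T d} → InB b m → InB b y → Tight b m T →
  (∀ t → m t < d → t ∈ T) → (∀ t → t ∈ T → m t ≤ d) → excess d (toList m) ≤ excess d (toList y)
excess-≤ {m = m} {y} {T} {d} m∈B y∈B tight contains within = begin
  excess d (toList m)                   ≡⟨ excess-toList d m ⟩
  sum (λ t → (m t - d) ⁺)               ≡⟨ sum-cong-≗ excess-outside ⟩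
  sum (restrict (∁ T) (λ t → m t - d))  ≡⟨ x̃≡sum _ (∁ T) ⟨
  x̃ (λ t → m t - d) (∁ T)               ≡⟨ x̃-sub m (λ _ → d) (∁ T) ⟩
  x̃ m (∁ T) - x̃ (λ _ → d) (∁ T)         ≤⟨ ℤP.+-monoˡ-≤ _ (tight-∁-minimal m∈B y∈B tight) ⟩
  x̃ y (∁ T) - x̃ (λ _ → d) (∁ T)         ≡⟨ x̃-sub y (λ _ → d) (∁ T) ⟨
  x̃ (λ t → y t - d) (∁ T)               ≡⟨ x̃≡sum _ (∁ T) ⟩
  sum (restrict (∁ T) (λ t → y t - d))  ≤⟨ sum-mono-≤ (λ t → []·-≤-⁺ _ (y t - d)) ⟩
  sum (λ t → (y t - d) ⁺)               ≡⟨ excess-toList d y ⟨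
  excess d (toList y)                   ∎
  where
  open ℤP.≤-Reasoning
  outside : ∀ t → (m t - d) ⁺ ≡ [ not (lookup T t) ]· (m t - d)
  outside t with lookup T t in t?T
  ... | true  = ℤP.i≤j⇒i⊔j≡j (ℤP.i≤j⇒i-j≤0 (within t (lookup⇒[]= t T t?T)))
  ... | false = ℤP.i≥j⇒i⊔j≡i (ℤP.i≤j⇒0≤j-i (ℤP.≮⇒≥ (lookup≡false⇒∉ t?T ∘ contains t)))
  excess-outside : ∀ t → (m t - d) ⁺ ≡ restrict (∁ T) (λ t → m t - d) t
  excess-outside t = trans (outside t) (cong ([_]· (m t - d)) (sym (lookup-map t not T)))

excess-nonneg : ∀ d as → + 0 ≤ excess d as
excess-nonneg d []       = ℤP.≤-refl
excess-nonneg d (a ∷ as) = ℤP.+-mono-≤ (ℤP.i≤j⊔i (a - d) (+ 0)) (excess-nonneg d as)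

excess-≡0 : ∀ {d} as → All (_≤ d) as → excess d as ≡ + 0
excess-≡0 []       []              = refl
excess-≡0 (a ∷ as) (a≤d ∷ as≤d) = cong₂ _+_ (ℤP.i≤j⇒i⊔j≡j (ℤP.i≤j⇒i-j≤0 a≤d)) (excess-≡0 as as≤d)

excess-≤0⇒head≤ : ∀ {d a} as → excess d (a ∷ as) ≤ + 0 → a ≤ d
excess-≤0⇒head≤ {d} {a} as excess≤0 = ℤP.i-j≤0⇒i≤j (begin
  a - d                        ≤⟨ ℤP.i≤i⊔j (a - d) (+ 0) ⟩
  (a - d) ⁺                    ≡⟨ ℤP.+-identityʳ _ ⟨
  (a - d) ⁺ + + 0              ≤⟨ ℤP.+-monoʳ-≤ ((a - d) ⁺) (excess-nonneg d as) ⟩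
  excess d (a ∷ as)            ≤⟨ excess≤0 ⟩
  + 0                          ∎)
  where open ℤP.≤-Reasoning

Descending : List ℤ → Set
Descending = AllPairs (λ a c → c ≤ a)

≤lex-of-excess : ∀ as bs → Descending bs → (∀ d → excess d as ≤ excess d bs) → as ≤lex bs
≤lex-of-excess []       []       _ _ = base tt
≤lex-of-excess []       (_ ∷ _)  _ _ = halt
≤lex-of-excess (a ∷ as) []       _ ≤excess =
  contradiction (excess-≤0⇒head≤ as (≤excess (ℤ.pred a))) (ℤP.<⇒≱ (ℤP.suc[i]≤j⇒i<j (ℤP.≤-reflexive (ℤP.suc-pred a))))
≤lex-of-excess (a ∷ as) (b ∷ bs) (b≥bs ∷ desc) ≤excess with ℤP.<-cmp a b
... | tri< a<b _ _ = this a<b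
... | tri≈ _ refl _ = next refl (≤lex-of-excess as bs desc λ d → +-cancelˡ-≤ ((a - d) ⁺) (≤excess d))
... | tri> _ _ b<a = contradiction
        (excess-≤0⇒head≤ as (subst (excess b (a ∷ as) ≤_) (excess-≡0 (b ∷ bs) (ℤP.≤-refl ∷ b≥bs)) (≤excess b)))
        (ℤP.<⇒≱ b<a)

≤lex-antisym : ∀ {as bs} → as ≤lex bs → bs ≤lex as → as ≡ bs
≤lex-antisym as≤bs bs≤as = Pointwise-≡⇒≡ (≤-antisymmetric sym ℤP.<-irrefl ℤP.<-asym as≤bs bs≤as)

sortDec-↭ : (x : Fin n → ℤ) → sortDec x ↭ toList x
sortDec-↭ x = ↭-trans (PermP.↭-reverse _) (IntSort.sort-↭ (toList x))

descending-reverse : ∀ as → AllPairs _≤_ as → Descending (reverse as)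
descending-reverse []       []           = []
descending-reverse (a ∷ as) (a≤as ∷ asc) rewrite ListP.unfold-reverse a as =
  AllPairsP.++⁺ (descending-reverse as asc) ([] ∷ [])
    (All.map (_∷ []) (PermP.All-resp-↭ (↭-sym (PermP.↭-reverse as)) a≤as))

sortDec-descending : (x : Fin n → ℤ) → Descending (sortDec x)
sortDec-descending x = descending-reverse _ (LinkedP.Linked⇒AllPairs ℤP.≤-trans (IntSort.sort-↗ (toList x)))

blocked⇒≤lex : ∀ {b : Subset n → ℤ∞} {m y} → IsBorder b → InB b m → Blocked b m → InB b y → sortDec m ≤lex sortDec y
blocked⇒≤lex {m = m} {y} isBorder m∈B blocked y∈B = ≤lex-of-excess _ _ (sortDec-descending y) λ d →
  let T , tight , contains , within = tight-between-levels isBorder m∈B blocked d in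
  subst₂ _≤_ (excess-↭ d (↭-sym (sortDec-↭ m))) (excess-↭ d (↭-sym (sortDec-↭ y)))
    (excess-≤ m∈B y∈B tight contains within)

-- The difference-sum

rowDist : ℤ → List ℤ → ℕ
rowDist a cs = sumℕ (map (λ c → ∣ a - c ∣) cs)

Δˡ : List ℤ → ℕ
Δˡ as = sumℕ (map (λ a → rowDist a as) as)

∣a-a∣≡0 : ∀ a → ∣ a - a ∣ ≡ 0
∣a-a∣≡0 a = cong ∣_∣ (ℤP.+-inverseʳ a)

Δ≡Δˡ : (x : Fin n → ℤ) → Δ x ≡ Δˡ (toList x)
Δ≡Δˡ {n} x = cong sumℕ (trans (ListP.map-cong row (allFin n)) (map-allFin (λ a → rowDist a (toList x))))
  where
  map-allFin : ∀ {A : Set} (f : ℤ → A) → map (f ∘ x) (allFin n) ≡ map f (toList x)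
  map-allFin f = trans (ListP.map-tabulate id (f ∘ x)) (sym (ListP.map-tabulate x f))
  diagonal : ∀ s t → (if does (s ≟ t) then 0 else ∣ x s - x t ∣) ≡ ∣ x s - x t ∣
  diagonal s t with s ≟ t
  ... | yes refl = sym (∣a-a∣≡0 (x s))
  ... | no  _    = refl
  row : ∀ s → sumℕ (map (λ t → if does (s ≟ t) then 0 else ∣ x s - x t ∣) (allFin n)) ≡ rowDist (x s) (toList x)
  row s = cong sumℕ (trans (ListP.map-cong (diagonal s) (allFin n)) (map-allFin (λ c → ∣ x s - c ∣)))

Δˡ-↭ : ∀ {as bs} → as ↭ bs → Δˡ as ≡ Δˡ bs
Δˡ-↭ {as} {bs} as↭bs = begin
  sumℕ (map (λ a → rowDist a as) as) ≡⟨ cong sumℕ (ListP.map-cong (λ a → sumℕ-↭ (PermP.map⁺ _ as↭bs)) as) ⟩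
  sumℕ (map (λ a → rowDist a bs) as) ≡⟨ sumℕ-↭ (PermP.map⁺ _ as↭bs) ⟩
  sumℕ (map (λ a → rowDist a bs) bs) ∎
  where open ≡-Reasoning

Δ-sortDec : (x z : Fin n → ℤ) → sortDec x ≡ sortDec z → Δ x ≡ Δ z
Δ-sortDec x z same = begin
  Δ x                ≡⟨ Δ≡Δˡ x ⟩
  Δˡ (toList x)      ≡⟨ Δˡ-↭ (↭-sym (sortDec-↭ x)) ⟩
  Δˡ (sortDec x)     ≡⟨ cong Δˡ same ⟩
  Δˡ (sortDec z)     ≡⟨ Δˡ-↭ (sortDec-↭ z) ⟩
  Δˡ (toList z)      ≡⟨ Δ≡Δˡ z ⟨
  Δ z                ∎
  where open ≡-Reasoning

sumℕ-map-mono : ∀ {A : Set} {f g : A → ℕ} as → (∀ a → f a ℕ.≤ g a) → sumℕ (map f as) ℕ.≤ sumℕ (map g as)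
sumℕ-map-mono []       f≤g = ℕ.z≤n
sumℕ-map-mono (a ∷ as) f≤g = ℕP.+-mono-≤ (f≤g a) (sumℕ-map-mono as f≤g)

Δˡ-∷∷ : ∀ p q R → Δˡ (p ∷ q ∷ R) ≡
  (∣ p - q ∣ ℕ.+ ∣ q - p ∣) ℕ.+ (rowDist p R ℕ.+ rowDist q R) ℕ.+ sumℕ (map (λ a → ∣ a - p ∣ ℕ.+ (∣ a - q ∣ ℕ.+ rowDist a R)) R)
Δˡ-∷∷ p q R rewrite ∣a-a∣≡0 p | ∣a-a∣≡0 q =
  regroup ∣ p - q ∣ ∣ q - p ∣ (rowDist p R) (rowDist q R) (sumℕ (map (λ a → ∣ a - p ∣ ℕ.+ (∣ a - q ∣ ℕ.+ rowDist a R)) R))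
  where
  regroup : ∀ a b c d s → a ℕ.+ c ℕ.+ (b ℕ.+ d ℕ.+ s) ≡ a ℕ.+ b ℕ.+ (c ℕ.+ d) ℕ.+ s
  regroup = solveℕ-∀

dist-≥ : ∀ {a r} → r ≤ a → + ∣ a - r ∣ ≡ a - r
dist-≥ {a} {r} r≤a = trans (cong +_ (ℤP.∣i-j∣≡∣j-i∣ a r)) (ℤP.∣-∣-≤ r≤a)

module _ {p q : ℤ} (gap : p + + 2 ≤ q) where

  private
    p≤p+1 : p ≤ p + + 1
    p≤p+1 = ℤP.i≤i+j p (+ 1)

    p+1≤q-1 : p + + 1 ≤ q - + 1
    p+1≤q-1 = subst (_≤ q - + 1) (shift p) (ℤP.+-monoˡ-≤ (- + 1) gap)
      where
      shift : ∀ p → p + + 2 - + 1 ≡ p + + 1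
      shift = solve-∀

    q-1≤q : q - + 1 ≤ q
    q-1≤q = ℤP.i≤j⇒i-k≤j (+ 1) ℤP.≤-refl

  dist-pair : 2 ℕ.+ ∣ p + + 1 - (q - + 1) ∣ ≡ ∣ p - q ∣
  dist-pair = ℤP.+-injective (begin
    + 2 + + ∣ p + + 1 - (q - + 1) ∣ ≡⟨ cong (_+_ (+ 2)) (ℤP.∣-∣-≤ p+1≤q-1) ⟩
    + 2 + (q - + 1 - (p + + 1))     ≡⟨ regroup p q ⟩
    q - p                           ≡⟨ ℤP.∣-∣-≤ (ℤP.≤-trans p≤p+1 (ℤP.≤-trans p+1≤q-1 q-1≤q)) ⟨
    + ∣ p - q ∣                     ∎)
    where
    open ≡-Reasoning
    regroup : ∀ p q → + 2 + (q - + 1 - (p + + 1)) ≡ q - p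
    regroup = solve-∀

  private
    Contracts : ℤ → Set
    Contracts r = + ∣ p + + 1 - r ∣ + + ∣ q - + 1 - r ∣ ≤ + ∣ p - r ∣ + + ∣ q - r ∣

    contracts-below : ∀ {r} → r ≤ p → Contracts r
    contracts-below {r} r≤p = ℤP.≤-reflexive (begin
      + ∣ p + + 1 - r ∣ + + ∣ q - + 1 - r ∣ ≡⟨ cong₂ _+_ (dist-≥ r≤p+1) (dist-≥ r≤q-1) ⟩
      (p + + 1 - r) + (q - + 1 - r)         ≡⟨ regroup p q r ⟩
      (p - r) + (q - r)                     ≡⟨ cong₂ _+_ (dist-≥ r≤p) (dist-≥ (ℤP.≤-trans r≤q-1 q-1≤q)) ⟨
      + ∣ p - r ∣ + + ∣ q - r ∣             ∎)
      where
      open ≡-Reasoning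
      r≤p+1 = ℤP.≤-trans r≤p p≤p+1
      r≤q-1 = ℤP.≤-trans r≤p+1 p+1≤q-1
      regroup : ∀ p q r → (p + + 1 - r) + (q - + 1 - r) ≡ (p - r) + (q - r)
      regroup = solve-∀

    contracts-above : ∀ {r} → q ≤ r → Contracts r
    contracts-above {r} q≤r = ℤP.≤-reflexive (begin
      + ∣ p + + 1 - r ∣ + + ∣ q - + 1 - r ∣ ≡⟨ cong₂ _+_ (ℤP.∣-∣-≤ p+1≤r) (ℤP.∣-∣-≤ (ℤP.≤-trans q-1≤q q≤r)) ⟩
      (r - (p + + 1)) + (r - (q - + 1))     ≡⟨ regroup p q r ⟩
      (r - p) + (r - q)                     ≡⟨ cong₂ _+_ (ℤP.∣-∣-≤ (ℤP.≤-trans p≤p+1 p+1≤r)) (ℤP.∣-∣-≤ q≤r) ⟨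
      + ∣ p - r ∣ + + ∣ q - r ∣             ∎)
      where
      open ≡-Reasoning
      p+1≤r = ℤP.≤-trans p+1≤q-1 (ℤP.≤-trans q-1≤q q≤r)
      regroup : ∀ p q r → (r - (p + + 1)) + (r - (q - + 1)) ≡ (r - p) + (r - q)
      regroup = solve-∀

    contracts-between : ∀ {r} → p < r → r < q → Contracts r
    contracts-between {r} p<r r<q = begin
      + ∣ p + + 1 - r ∣ + + ∣ q - + 1 - r ∣ ≡⟨ cong₂ _+_ (ℤP.∣-∣-≤ p+1≤r) (dist-≥ r≤q-1) ⟩
      (r - (p + + 1)) + (q - + 1 - r)       ≡⟨ regroup p q r ⟩
      (r - p) + (q - r) - + 2               ≤⟨ ℤP.i≤j⇒i-k≤j (+ 2) ℤP.≤-refl ⟩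
      (r - p) + (q - r)                     ≡⟨ cong₂ _+_ (ℤP.∣-∣-≤ (ℤP.<⇒≤ p<r)) (dist-≥ (ℤP.<⇒≤ r<q)) ⟨
      + ∣ p - r ∣ + + ∣ q - r ∣             ∎
      where
      open ℤP.≤-Reasoning
      p+1≤r = subst (_≤ r) (ℤP.+-comm (+ 1) p) (ℤP.i<j⇒suc[i]≤j p<r)
      r≤q-1 = subst (r ≤_) (ℤP.+-comm (- + 1) q) (ℤP.i<j⇒i≤pred[j] r<q)
      regroup : ∀ p q r → (r - (p + + 1)) + (q - + 1 - r) ≡ (r - p) + (q - r) - + 2
      regroup = solve-∀

  dist-contract : ∀ r → ∣ p + + 1 - r ∣ ℕ.+ ∣ q - + 1 - r ∣ ℕ.≤ ∣ p - r ∣ ℕ.+ ∣ q - r ∣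
  dist-contract r = ℤP.drop‿+≤+ (subst₂ _≤_
    (sym (ℤP.pos-+ ∣ p + + 1 - r ∣ ∣ q - + 1 - r ∣)) (sym (ℤP.pos-+ ∣ p - r ∣ ∣ q - r ∣)) contracts)
    where
    contracts : Contracts r
    contracts with r ℤP.≤? p | q ℤP.≤? r
    ... | yes r≤p | _        = contracts-below r≤p
    ... | no  _   | yes q≤r  = contracts-above q≤r
    ... | no  r≰p | no  q≰r  = contracts-between (ℤP.≰⇒> r≰p) (ℤP.≰⇒> q≰r)

  rowDist-contract : ∀ R → rowDist (p + + 1) R ℕ.+ rowDist (q - + 1) R ℕ.≤ rowDist p R ℕ.+ rowDist q R
  rowDist-contract []      = ℕ.z≤n
  rowDist-contract (r ∷ R) = subst₂ ℕ._≤_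
    (regroup ∣ p + + 1 - r ∣ ∣ q - + 1 - r ∣ (rowDist (p + + 1) R) (rowDist (q - + 1) R))
    (regroup ∣ p - r ∣ ∣ q - r ∣ (rowDist p R) (rowDist q R))
    (ℕP.+-mono-≤ (dist-contract r) (rowDist-contract R))
    where
    regroup : ∀ a b c d → a ℕ.+ b ℕ.+ (c ℕ.+ d) ≡ a ℕ.+ c ℕ.+ (b ℕ.+ d)
    regroup = solveℕ-∀

  Δˡ-contract : ∀ R → Δˡ (p + + 1 ∷ q - + 1 ∷ R) ℕ.< Δˡ (p ∷ q ∷ R)
  Δˡ-contract R = subst₂ ℕ._<_ (sym (Δˡ-∷∷ (p + + 1) (q - + 1) R)) (sym (Δˡ-∷∷ p q R))
    (ℕP.+-mono-<-≤ (ℕP.+-mono-<-≤ pair (rowDist-contract R)) (sumℕ-map-mono R column))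
    where
    p′ = p + + 1
    q′ = q - + 1
    pair : ∣ p′ - q′ ∣ ℕ.+ ∣ q′ - p′ ∣ ℕ.< ∣ p - q ∣ ℕ.+ ∣ q - p ∣
    pair rewrite ℤP.∣i-j∣≡∣j-i∣ q′ p′ | ℤP.∣i-j∣≡∣j-i∣ q p | sym dist-pair =
      ℕP.+-mono-<-≤ (ℕP.m<n+m ∣ p′ - q′ ∣ {2} (ℕ.s≤s ℕ.z≤n)) (ℕP.m≤n+m ∣ p′ - q′ ∣ 2)
    column : ∀ a → ∣ a - p′ ∣ ℕ.+ (∣ a - q′ ∣ ℕ.+ rowDist a R) ℕ.≤ ∣ a - p ∣ ℕ.+ (∣ a - q ∣ ℕ.+ rowDist a R)
    column a rewrite ℤP.∣i-j∣≡∣j-i∣ a p′ | ℤP.∣i-j∣≡∣j-i∣ a q′ | ℤP.∣i-j∣≡∣j-i∣ a p | ℤP.∣i-j∣≡∣j-i∣ a q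
                   | sym (ℕP.+-assoc ∣ p′ - a ∣ ∣ q′ - a ∣ (rowDist a R)) | sym (ℕP.+-assoc ∣ p - a ∣ ∣ q - a ∣ (rowDist a R)) =
      ℕP.+-monoˡ-≤ (rowDist a R) (dist-contract a)

tabulate-↭-removeAt : ∀ {A : Set} (f : Fin (suc n) → A) i → tabulate f ↭ f i ∷ tabulate (removeAt f i)
tabulate-↭-removeAt         f zero    = ↭-refl
tabulate-↭-removeAt {suc n} f (suc i) =
  ↭-trans (↭-prep (f zero) (tabulate-↭-removeAt (f ∘ suc) i)) (↭-swap (f zero) (f (suc i)) ↭-refl)

tabulate-↭-pair : ∀ {A : Set} (f : Fin (suc (suc n)) → A) {v u} (v≢u : v ≢ u) →
  tabulate f ↭ f v ∷ f u ∷ tabulate (f ∘ punchIn v ∘ punchIn (punchOut v≢u))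
tabulate-↭-pair f {v} {u} v≢u = ↭-trans (tabulate-↭-removeAt f v) (↭-prep (f v)
  (subst (λ w → tabulate (removeAt f v) ↭ f w ∷ tabulate (f ∘ punchIn v ∘ punchIn (punchOut v≢u)))
    (FinP.punchIn-punchOut v≢u) (tabulate-↭-removeAt (f ∘ punchIn v) (punchOut v≢u))))

gap⇒≢ : ∀ {x : Fin n → ℤ} {u v} → x v + + 2 ≤ x u → v ≢ u
gap⇒≢ {x = x} {v = v} gap refl with +-cancelˡ-≤ (x v) (subst (x v + + 2 ≤_) (sym (ℤP.+-identityʳ (x v))) gap)
... | ℤ.+≤+ ()

Δ-moveUnit-< : (x : Fin n → ℤ) {u v : Fin n} → x v + + 2 ≤ x u → Δ (moveUnit x u v) ℕ.< Δ x
Δ-moveUnit-< {suc zero}    x {zero} {zero} gap = contradiction refl (gap⇒≢ {x = x} gap)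
Δ-moveUnit-< {suc (suc n)} x {u} {v} gap = begin-strict
  Δ (moveUnit x u v)                                  ≡⟨ Δ≡Δˡ (moveUnit x u v) ⟩
  Δˡ (toList (moveUnit x u v))                        ≡⟨ Δˡ-↭ (tabulate-↭-pair (moveUnit x u v) v≢u) ⟩
  Δˡ (moveUnit x u v v ∷ moveUnit x u v u ∷ tabulate (moveUnit x u v ∘ rest))
    ≡⟨ cong₂ (λ a c → Δˡ (a ∷ c)) (moveUnit-at-to x (v≢u ∘ sym)) (cong₂ _∷_ (moveUnit-at-from x v≢u) (ListP.tabulate-cong unchanged)) ⟩
  Δˡ (x v + + 1 ∷ x u - + 1 ∷ tabulate (x ∘ rest))    <⟨ Δˡ-contract {x v} {x u} gap (tabulate (x ∘ rest)) ⟩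
  Δˡ (x v ∷ x u ∷ tabulate (x ∘ rest))                ≡⟨ Δˡ-↭ (tabulate-↭-pair x v≢u) ⟨
  Δˡ (toList x)                                       ≡⟨ Δ≡Δˡ x ⟨
  Δ x                                                 ∎
  where
  open ℕP.≤-Reasoning
  v≢u = gap⇒≢ {x = x} gap
  rest = punchIn v ∘ punchIn (punchOut v≢u)
  unchanged : ∀ k → moveUnit x u v (rest k) ≡ x (rest k)
  unchanged k = moveUnit-elsewhere x u≢rest (FinP.punchInᵢ≢i v _ ∘ sym)
    where
    u≢rest : u ≢ rest k
    u≢rest u≡rest = FinP.punchInᵢ≢i (punchOut v≢u) k (sym (FinP.punchIn-injective v _ _
      (trans (FinP.punchIn-punchOut v≢u) u≡rest)))

descend-to-blocked : ∀ {b : Subset n → ℤ∞} z → InB b z → ∃[ z′ ] InB b z′ × Blocked b z′ × Δ z′ ℕ.≤ Δ z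
descend-to-blocked {b = b} z z∈B = go z z∈B (<-wellFounded (Δ z))
  where
  go : ∀ z → InB b z → Acc ℕ._<_ (Δ z) → ∃[ z′ ] InB b z′ × Blocked b z′ × Δ z′ ℕ.≤ Δ z
  go z z∈B (acc smaller) with tighteningMove-or-blocked b z z∈B
  ... | inj₂ blocked = z , z∈B , blocked , ℕP.≤-refl
  ... | inj₁ (u , v , gap , moved∈B) =
    let z′ , z′∈B , blocked , Δz′≤ = go (moveUnit z u v) moved∈B (smaller (Δ-moveUnit-< z gap))
    in z′ , z′∈B , blocked , ℕP.≤-trans Δz′≤ (ℕP.<⇒≤ (Δ-moveUnit-< z gap))

theorem6p7 : (n : ℕ) (b : Subset (suc n) → ℤ∞) → IsBorder b →
    (m : Fin (suc n) → ℤ) →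
    (ΔMinimizer b m → DecMin b m) × (DecMin b m → ΔMinimizer b m)
theorem6p7 n b isBorder m = ΔMinimizer⇒DecMin , DecMin⇒ΔMinimizer
  where
  ΔMinimizer⇒DecMin : ΔMinimizer b m → DecMin b m
  ΔMinimizer⇒DecMin (m∈B , minimal) with tighteningMove-or-blocked b m m∈B
  ... | inj₁ (u , v , gap , moved∈B) = contradiction (minimal _ moved∈B) (ℕP.<⇒≱ (Δ-moveUnit-< m gap))
  ... | inj₂ blocked = m∈B , λ y y∈B → blocked⇒≤lex isBorder m∈B blocked y∈B

  DecMin⇒ΔMinimizer : DecMin b m → ΔMinimizer b m
  DecMin⇒ΔMinimizer (m∈B , decMin) = m∈B , λ z z∈B →
    let z′ , z′∈B , blocked , Δz′≤Δz = descend-to-blocked z z∈B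
        sameSorted = ≤lex-antisym (decMin z′ z′∈B) (blocked⇒≤lex isBorder z′∈B blocked m∈B)
    in ℕP.≤-trans (ℕP.≤-reflexive (Δ-sortDec m z′ sameSorted)) Δz′≤Δz
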